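{- For every tree $T_r=(V,E)$ rooted at $r$, $$f(T_r)\ \ge\ \frac{|V|}{2\,h(T_r)}-\frac12 .$$
   Context: For a rooted tree $T_r$, $h(T_r)$ denotes the number of vertices on a longest path in $T_r$ starting at the root $r$ (so a single vertex has $h=1$); for the empty tree $T_\emptyset$ set $h(T_\emptyset)=0$. For a rooted tree $T_r$ with at least two vertices, let $v_1,\ldots,v_{k'}$ be the children of $r$ and $T_{v_i}$ the subtree rooted at $v_i$ consisting of $v_i$ and its descendants, ordered so that $h(T_{v_1})\ge h(T_{v_2})\ge\cdots\ge h(T_{v_{k'}})$; if $k'$ is even put $k=k'$, and if $k'$ is odd put $k=k'+1$ and $T_{v_k}=T_\emptyset$. The function $f$ is defined recursively by $f(T_r)=0$ if $T_r$ has at most one vertex (including the empty tree), and otherwise $$f(T_r)=\max\Big\{\sum_{i=1}^{k} f(T_{v_i}),\ \sum_{i=1}^{k/2} h(T_{v_{2i}})\Big\}.$$ -}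

module Defs where

open import Data.Nat using (ℕ; zero; suc; _+_; _*_; _⊔_; _≤ᵇ_)
open import Data.List using (List; []; _∷_)
open import Data.Bool using (if_then_else_)

-- The root of  node cs  is the new vertex; every such value is a
-- (nonempty) rooted tree, and every finite rooted tree is represented.
data Tree : Set where
  node : List Tree → Tree

mutual
  size : Tree → ℕ
  size (node cs) = suc (sizes cs)

  sizes : List Tree → ℕ
  sizes []       = 0
  sizes (t ∷ ts) = size t + sizes ts

-- h(T_r): number of vertices on a longest path starting at the root
mutual
  height : Tree → ℕ
  height (node cs) = suc (maxHeight cs)

  maxHeight : List Tree → ℕ
  maxHeight []       = 0
  maxHeight (t ∷ ts) = height t ⊔ maxHeight ts

  heights : List Tree → List ℕ
  heights []       = []
  heights (t ∷ ts) = height t ∷ heights ts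

insertDesc : ℕ → List ℕ → List ℕ
insertDesc x []       = x ∷ []
insertDesc x (y ∷ ys) = if y ≤ᵇ x then x ∷ y ∷ ys else y ∷ insertDesc x ys

sortDesc : List ℕ → List ℕ
sortDesc []       = []
sortDesc (x ∷ xs) = insertDesc x (sortDesc xs)

-- for a list a₁, a₂, a₃, … return a₂ + a₄ + a₆ + …
-- (a missing partner at the end, i.e. the empty tree with h = 0, contributes 0)
sumEvenPos : List ℕ → ℕ
sumEvenPos []             = 0
sumEvenPos (_ ∷ [])       = 0
sumEvenPos (_ ∷ b ∷ rest) = b + sumEvenPos rest

mutual
  f : Tree → ℕ
  f (node [])        = 0
  f (node (c ∷ cs))  = sumF (c ∷ cs) ⊔ sumEvenPos (sortDesc (heights (c ∷ cs)))

  sumF : List Tree → ℕ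
  sumF []       = 0
  sumF (t ∷ ts) = f t + sumF ts

-- A child of height hᵢ has at most 2 hᵢ f(Tᵢ) + hᵢ ≤ 2 M f(Tᵢ) + hᵢ
-- vertices, M the largest child height, so the children have at most 2 M Σ f(Tᵢ) + Σ hᵢ
-- vertices.  In the non-increasing list of child heights each height at an odd position is
-- at most its predecessor (the first one at most M), hence Σ hᵢ ≤ M + 2 Σ h(T_{v_{2i}}).
-- Both Σ f(Tᵢ) and Σ h(T_{v_{2i}}) are at most f(T), and adding the root gives the bound
-- with height M + 1.
module Submission where

open import Defs
open import Data.Nat using (suc; _+_; _*_; _≤_; _≥_; _≤ᵇ_; z≤n; s≤s)
open import Data.Nat.Properties
open import Data.Nat.ListAction using (sum)
open import Data.Nat.ListAction.Properties using (sum-↭)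
open import Data.Nat.Solver using (module +-*-Solver)
open import Data.List using ([]; _∷_)
open import Data.List.Relation.Unary.All as All using (All; []; _∷_)
open import Data.List.Relation.Unary.Linked using (Linked; []; [-]; _∷_)
open import Data.List.Relation.Binary.Permutation.Propositional
  using (_↭_; refl; prep; swap; trans)
open import Data.Bool using (true; false)
open import Relation.Nullary.Reflects using (ofʸ; ofⁿ)
open import Relation.Binary.PropositionalEquality as ≡ using (sym)
open +-*-Solver

insertDesc-↭ : ∀ x ys → insertDesc x ys ↭ x ∷ ys
insertDesc-↭ x []       = refl
insertDesc-↭ x (y ∷ ys) with y ≤ᵇ x
... | true  = refl
... | false = trans (prep y (insertDesc-↭ x ys)) (swap y x refl)

sortDesc-↭ : ∀ xs → sortDesc xs ↭ xs
sortDesc-↭ []       = refl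
sortDesc-↭ (x ∷ xs) = trans (insertDesc-↭ x (sortDesc xs)) (prep x (sortDesc-↭ xs))

insertDesc-linked : ∀ {m} x ys → x ≤ m → Linked _≥_ (m ∷ ys) → Linked _≥_ (m ∷ insertDesc x ys)
insertDesc-linked x []       x≤m _             = x≤m ∷ [-]
insertDesc-linked x (y ∷ ys) x≤m (y≤m ∷ y∷ys↓) with y ≤ᵇ x | ≤ᵇ-reflects-≤ y x
... | true  | ofʸ y≤x = x≤m ∷ y≤x ∷ y∷ys↓
... | false | ofⁿ y≰x = y≤m ∷ insertDesc-linked x ys (<⇒≤ (≰⇒> y≰x)) y∷ys↓

sortDesc-linked : ∀ {m} xs → All (_≤ m) xs → Linked _≥_ (m ∷ sortDesc xs)
sortDesc-linked []       []           = [-]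
sortDesc-linked (x ∷ xs) (x≤m ∷ xs≤m) =
  insertDesc-linked x (sortDesc xs) x≤m (sortDesc-linked xs xs≤m)

sum≤+2*sumEvenPos : ∀ {m} xs → Linked _≥_ (m ∷ xs) → sum xs ≤ m + 2 * sumEvenPos xs
sum≤+2*sumEvenPos []               _                    = z≤n
sum≤+2*sumEvenPos (a ∷ [])         (a≤m ∷ [-])          = +-monoˡ-≤ 0 a≤m
sum≤+2*sumEvenPos {m} (a ∷ b ∷ xs) (a≤m ∷ b≤a ∷ b∷xs↓) = begin
  a + (b + sum xs)                  ≤⟨ +-mono-≤ a≤m (+-monoʳ-≤ b (sum≤+2*sumEvenPos xs b∷xs↓)) ⟩
  m + (b + (b + 2 * sumEvenPos xs)) ≡⟨ solve 3 (λ m b s → m :+ (b :+ (b :+ con 2 :* s))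
                                                      := m :+ con 2 :* (b :+ s))
                                               ≡.refl m b (sumEvenPos xs) ⟩
  m + 2 * (b + sumEvenPos xs)       ∎
  where open ≤-Reasoning

heights≤maxHeight : ∀ cs → All (_≤ maxHeight cs) (heights cs)
heights≤maxHeight []       = []
heights≤maxHeight (t ∷ ts) =
  m≤m⊔n (height t) (maxHeight ts)
  ∷ All.map (λ h≤ → ≤-trans h≤ (m≤n⊔m (height t) (maxHeight ts))) (heights≤maxHeight ts)

sum-heights≤ : ∀ cs → sum (heights cs) ≤ maxHeight cs + 2 * sumEvenPos (sortDesc (heights cs))
sum-heights≤ cs = begin
  sum hs            ≡⟨ sym (sum-↭ (sortDesc-↭ hs)) ⟩
  sum (sortDesc hs) ≤⟨ sum≤+2*sumEvenPos (sortDesc hs) (sortDesc-linked hs (heights≤maxHeight cs)) ⟩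
  maxHeight cs + 2 * sumEvenPos (sortDesc hs) ∎
  where
  open ≤-Reasoning
  hs = heights cs

add-root : ∀ {s M F S H g} → s ≤ 2 * M * F + H → H ≤ M + 2 * S → F ≤ g → S ≤ g →
           suc s ≤ 2 * suc M * g + suc M
add-root {s} {M} {F} {S} {H} {g} s≤ H≤ F≤g S≤g = begin
  suc s                           ≤⟨ s≤s s≤ ⟩
  suc (2 * M * F + H)             ≤⟨ s≤s (+-mono-≤ (*-monoʳ-≤ (2 * M) F≤g) H≤) ⟩
  suc (2 * M * g + (M + 2 * S))   ≤⟨ s≤s (+-monoʳ-≤ (2 * M * g) (+-monoʳ-≤ M (*-monoʳ-≤ 2 S≤g))) ⟩
  suc (2 * M * g + (M + 2 * g))   ≡⟨ solve 2 (λ M g → con 1 :+ (con 2 :* M :* g :+ (M :+ con 2 :* g))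
                                                 := con 2 :* (con 1 :+ M) :* g :+ (con 1 :+ M))
                                          ≡.refl M g ⟩
  2 * suc M * g + suc M           ∎
  where open ≤-Reasoning

mutual
  sizes≤ : ∀ {m} cs → maxHeight cs ≤ m → sizes cs ≤ 2 * m * sumF cs + sum (heights cs)
  sizes≤ []           _ = z≤n
  sizes≤ {m} (t ∷ ts) ≤m = begin
    size t + sizes ts
      ≤⟨ +-mono-≤ (lemma2 t) (sizes≤ ts (m⊔n≤o⇒n≤o (height t) (maxHeight ts) ≤m)) ⟩
    (2 * height t * f t + height t) + (2 * m * sumF ts + sum (heights ts))
      ≤⟨ +-monoˡ-≤ _ (+-monoˡ-≤ (height t)
           (*-monoˡ-≤ (f t) (*-monoʳ-≤ 2 (m⊔n≤o⇒m≤o (height t) (maxHeight ts) ≤m)))) ⟩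
    (2 * m * f t + height t) + (2 * m * sumF ts + sum (heights ts))
      ≡⟨ solve 5 (λ m a h b s → (con 2 :* m :* a :+ h) :+ (con 2 :* m :* b :+ s)
                              := con 2 :* m :* (a :+ b) :+ (h :+ s))
                 ≡.refl m (f t) (height t) (sumF ts) (sum (heights ts)) ⟩
    2 * m * (f t + sumF ts) + (height t + sum (heights ts)) ∎
    where open ≤-Reasoning

  lemma2 : (T : Tree) → size T ≤ 2 * height T * f T + height T
  lemma2 (node [])       = s≤s z≤n
  lemma2 (node (c ∷ cs)) =
    add-root (sizes≤ (c ∷ cs) ≤-refl) (sum-heights≤ (c ∷ cs)) (m≤m⊔n F S) (m≤n⊔m F S)
    where
    F = sumF (c ∷ cs)
    S = sumEvenPos (sortDesc (heights (c ∷ cs)))
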